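{- Let $G$ be a finite group which has no maximal cyclic subgroup of order $2$. Then the oriented diameter of the power graph $Pow(G)$ is at most $4$.
   Context: For a finite group $G$, the power graph $Pow(G)$ is the simple undirected graph with vertex set $G$ in which two distinct elements $x,y$ are adjacent if and only if one of them is an integer power of the other. A cyclic subgroup $C$ of $G$ is a maximal cyclic subgroup if it is not properly contained in any cyclic subgroup of $G$. An orientation of an undirected graph $X$ assigns exactly one direction to each edge of $X$. For a directed graph $D$, $d_D(u,v)$ is the length of a shortest directed path from $u$ to $v$ ($\infty$ if none exists), and $diam(D)=\max_{u,v} d_D(u,v)$. The oriented diameter $OD(X)$ of $X$ is the minimum of $diam(D)$ over all directed graphs $D$ obtained from $X$ by an orientation. -}

module Defs where

open import Data.Nat using (ℕ; zero; suc)
open import Data.Integer using (ℤ; +_; -[1+_])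
open import Data.Fin using (Fin)
open import Data.Bool using (Bool; true)
open import Data.Product using (Σ; ∃; ∃-syntax; _×_; _,_)
open import Data.Sum using (_⊎_)
open import Relation.Nullary using (¬_)
open import Relation.Binary.PropositionalEquality using (_≡_; _≢_)
open import Algebra.Core using (Op₁; Op₂)
open import Algebra.Structures using (IsGroup)

-- A finite group of order n, presented (up to isomorphism) on the carrier Fin n,
-- with propositional equality as the group equality.
record FinGroup (n : ℕ) : Set where
  field
    _∙_     : Op₂ (Fin n)
    ε       : Fin n
    _⁻¹     : Op₁ (Fin n)
    isGroup : IsGroup _≡_ _∙_ ε _⁻¹

module _ {n : ℕ} (G : FinGroup n) where
  open FinGroup G

  pow : Fin n → ℕ → Fin n
  pow x zero    = ε
  pow x (suc k) = x ∙ pow x k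

  powℤ : Fin n → ℤ → Fin n
  powℤ x (+ k)     = pow x k
  powℤ x -[1+ k ]  = (pow x (suc k)) ⁻¹

  _∈⟨_⟩ : Fin n → Fin n → Set
  x ∈⟨ g ⟩ = ∃[ k ] x ≡ powℤ g k

  _⊆⟨⟩_ : Fin n → Fin n → Set
  g ⊆⟨⟩ h = ∀ x → x ∈⟨ g ⟩ → x ∈⟨ h ⟩

  MaximalCyclic : Fin n → Set
  MaximalCyclic g = ∀ h → g ⊆⟨⟩ h → h ⊆⟨⟩ g

  HasOrderTwo : Fin n → Set
  HasOrderTwo g = ∃[ a ] ∃[ b ] (a ≢ b × a ∈⟨ g ⟩ × b ∈⟨ g ⟩ ×
                     (∀ x → x ∈⟨ g ⟩ → x ≡ a ⊎ x ≡ b))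

  NoMaxCyclicOfOrderTwo : Set
  NoMaxCyclicOfOrderTwo = ¬ (∃[ g ] (MaximalCyclic g × HasOrderTwo g))

  PowAdj : Fin n → Fin n → Set
  PowAdj x y = x ≢ y × ((∃[ k ] x ≡ powℤ y k) ⊎ (∃[ k ] y ≡ powℤ x k))

  -- an orientation of Pow(G): o x y ≡ true means the edge {x,y} is directed x → y.
  -- Arcs only on edges, and every edge gets exactly one direction.
  IsOrientation : (Fin n → Fin n → Bool) → Set
  IsOrientation o =
    (∀ x y → o x y ≡ true → PowAdj x y) ×
    (∀ x y → PowAdj x y → (o x y ≡ true ⊎ o y x ≡ true)) ×
    (∀ x y → o x y ≡ true → ¬ (o y x ≡ true))

-- there is a directed walk of length at most k from x to y, i.e. d_D(x,y) ≤ k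
Reach : {n : ℕ} → (Fin n → Fin n → Bool) → ℕ → Fin n → Fin n → Set
Reach o zero    x y = x ≡ y
Reach o (suc k) x y = x ≡ y ⊎ ∃[ z ] (o x z ≡ true × Reach o k z y)

OrientedDiamAtMost : {n : ℕ} → FinGroup n → ℕ → Set
OrientedDiamAtMost G k =
  ∃[ o ] (IsOrientation G o × (∀ u v → Reach o k u v))

{-# OPTIONS --safe #-}
-- Split the elements x ≠ ε of G into involutions and pairs {x, x⁻¹}; in each
-- pair the member listed first in Fin n is "small", the other one "large".
-- Orient ε → small → large → ε and ε → involution → small, large (arbitrarily
-- inside a class). Then ε reaches every v in two steps (a large v through
-- v⁻¹), and every u reaches ε in two steps: a small u through u⁻¹, an
-- involution u through a large h with u ∈ ⟨h⟩. Such an h exists: otherwise a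
-- cyclic ⟨h⟩ ∋ u is generated neither by a large h nor by a small one (h⁻¹
-- would be large), so h is an involution and ⟨h⟩ = {ε, u}; then ⟨u⟩ would be
-- a maximal cyclic subgroup of order 2.
module Submission where

open import Defs hiding (_∈⟨_⟩)
open import Data.Nat using (ℕ; zero; suc; _+_; _≤_; z≤n; s≤s; s≤s⁻¹)
import Data.Nat as ℕ
open import Data.Nat.Properties using (+-suc; n<1+n; m≤n+m; m≤n⇒∃[o]m+o≡n; <⇒≱)
import Data.Nat.Properties as ℕ
open import Data.Integer using (+_; -[1+_])
open import Data.Fin using (Fin; toℕ; fromℕ<; _<_; _<?_)
open import Data.Fin.Properties using (_≟_; <-cmp; <-irrefl; <-asym; <⇒≢; any?; pigeonhole; toℕ-fromℕ<)
open import Data.Bool using (Bool; true; false; not; _∧_)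
open import Data.Bool.Properties using (∧-conicalˡ; ∧-conicalʳ; not-¬; ¬-not) renaming (_≟_ to _≟ᵇ_)
open import Data.Product using (∃; ∃-syntax; _×_; _,_; proj₁; proj₂)
open import Data.Sum using (_⊎_; inj₁; inj₂; swap)
import Data.Sum as Sum
open import Data.Empty using (⊥-elim)
open import Relation.Nullary using (¬_; Dec; yes; no; does)
open import Relation.Nullary.Decidable using (dec-true; dec-false; map′; _×-dec_; _⊎-dec_; ¬?)
open import Relation.Binary.Definitions using (tri<; tri≈; tri>)
open import Relation.Binary.PropositionalEquality
open import Level using (0ℓ)
open import Algebra.Bundles using (Group)
open import Algebra.Structures using (IsGroup)
import Algebra.Properties.Group as GroupProperties

module ReachProperties {n : ℕ} (o : Fin n → Fin n → Bool) where

  Reach-refl : ∀ k {x} → Reach o k x x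
  Reach-refl zero    = refl
  Reach-refl (suc k) = inj₁ refl

  Reach-arc : ∀ {k x y z} → o x y ≡ true → Reach o k y z → Reach o (suc k) x z
  Reach-arc {y = y} x→y y⇝z = inj₂ (y , x→y , y⇝z)

  Reach-mono : ∀ {j k x y} → j ≤ k → Reach o j x y → Reach o k x y
  Reach-mono {k = k} z≤n refl = Reach-refl k
  Reach-mono (s≤s j≤k) (inj₁ x≡y)             = inj₁ x≡y
  Reach-mono (s≤s j≤k) (inj₂ (z , x→z , z⇝y)) = inj₂ (z , x→z , Reach-mono j≤k z⇝y)

  Reach-++ : ∀ j {k x y z} → Reach o j x y → Reach o k y z → Reach o (j + k) x z
  Reach-++ zero    refl y⇝z = y⇝z
  Reach-++ (suc j) {k} (inj₁ refl) y⇝z = Reach-mono (m≤n+m k (suc j)) y⇝z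
  Reach-++ (suc j) (inj₂ (w , x→w , w⇝y)) y⇝z = Reach-arc x→w (Reach-++ j w⇝y y⇝z)

Tournament : ∀ {n} → (Fin n → Fin n → Bool) → Set
Tournament t = ∀ x y → x ≢ y → t y x ≡ not (t x y)

<ᵇ-tournament : ∀ {n} → Tournament (λ (x y : Fin n) → does (x <? y))
<ᵇ-tournament x y x≢y with <-cmp x y
... | tri< x<y _ _ rewrite dec-true (x <? y) x<y | dec-false (y <? x) (<-asym x<y) = refl
... | tri≈ _ x≡y _ = ⊥-elim (x≢y x≡y)
... | tri> _ _ y<x rewrite dec-true (y <? x) y<x | dec-false (x <? y) (<-asym y<x) = refl

data Class : Set where
  neutral small large involutive : Class

between : Class → Class → Bool → Bool
between neutral    neutral    tie = tie
between neutral    small      _   = true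
between neutral    large      _   = false
between neutral    involutive _   = true
between small      neutral    _   = false
between small      small      tie = tie
between small      large      _   = true
between small      involutive _   = false
between large      neutral    _   = true
between large      small      _   = false
between large      large      tie = tie
between large      involutive _   = false
between involutive neutral    _   = false
between involutive small      _   = true
between involutive large      _   = true
between involutive involutive tie = tie

between-flip : ∀ c d tie → between d c (not tie) ≡ not (between c d tie)
between-flip neutral    neutral    _ = refl
between-flip neutral    small      _ = refl
between-flip neutral    large      _ = refl
between-flip neutral    involutive _ = refl
between-flip small      neutral    _ = refl
between-flip small      small      _ = refl
between-flip small      large      _ = refl
between-flip small      involutive _ = refl
between-flip large      neutral    _ = refl
between-flip large      small      _ = refl
between-flip large      large      _ = refl
between-flip large      involutive _ = refl
between-flip involutive neutral    _ = refl
between-flip involutive small      _ = refl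
between-flip involutive large      _ = refl
between-flip involutive involutive _ = refl

module _ {n : ℕ} (G : FinGroup n) where
  open FinGroup G renaming (_∙_ to infixl 7 _∙_; _⁻¹ to infix 8 _⁻¹)
  open IsGroup isGroup using (assoc; identityˡ; identityʳ; inverseʳ)

  group : Group 0ℓ 0ℓ
  group = record
    { Carrier = Fin n ; _≈_ = _≡_ ; _∙_ = _∙_ ; ε = ε ; _⁻¹ = _⁻¹ ; isGroup = isGroup }

  open GroupProperties group
    using (ε⁻¹≈ε; ⁻¹-involutive; ⁻¹-anti-homo-∙; inverseʳ-unique; ∙-cancelˡ)
  open ≡-Reasoning

  infixr 8 _^_
  _^_ : Fin n → ℕ → Fin n
  _^_ = pow G

  _∈⟨_⟩ : Fin n → Fin n → Set
  _∈⟨_⟩ = Defs._∈⟨_⟩ G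

  ^-+ : ∀ g a b → g ^ (a + b) ≡ g ^ a ∙ g ^ b
  ^-+ g zero    b = sym (identityˡ _)
  ^-+ g (suc a) b = trans (cong (g ∙_) (^-+ g a b)) (sym (assoc _ _ _))

  ^-sucʳ : ∀ g m → g ^ suc m ≡ g ^ m ∙ g
  ^-sucʳ g zero    = trans (identityʳ g) (sym (identityˡ g))
  ^-sucʳ g (suc m) = trans (cong (g ∙_) (^-sucʳ g m)) (sym (assoc _ _ _))

  ⁻¹-^ : ∀ g m → (g ⁻¹) ^ m ≡ (g ^ m) ⁻¹
  ⁻¹-^ g zero    = sym ε⁻¹≈ε
  ⁻¹-^ g (suc m) = begin
    g ⁻¹ ∙ (g ⁻¹) ^ m  ≡⟨ cong (g ⁻¹ ∙_) (⁻¹-^ g m) ⟩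
    g ⁻¹ ∙ (g ^ m) ⁻¹  ≡⟨ ⁻¹-anti-homo-∙ (g ^ m) g ⟨
    (g ^ m ∙ g) ⁻¹     ≡⟨ cong _⁻¹ (^-sucʳ g m) ⟨
    (g ^ suc m) ⁻¹     ∎

  finite-order : ∀ g → ∃[ q ] g ^ suc q ≡ ε
  finite-order g =
    let i , j , i<j , gⁱ≡gʲ = pigeonhole (n<1+n n) (λ (i : Fin (suc n)) → g ^ toℕ i)
        o , 1+i+o≡j = m≤n⇒∃[o]m+o≡n i<j
    in o , ∙-cancelˡ (g ^ toℕ i) _ _ (begin
      g ^ toℕ i ∙ g ^ suc o  ≡⟨ ^-+ g (toℕ i) (suc o) ⟨
      g ^ (toℕ i + suc o)    ≡⟨ cong (g ^_) (trans (+-suc (toℕ i) o) 1+i+o≡j) ⟩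
      g ^ toℕ j              ≡⟨ gⁱ≡gʲ ⟨
      g ^ toℕ i              ≡⟨ identityʳ _ ⟨
      g ^ toℕ i ∙ ε          ∎)

  module _ (g : Fin n) where
    private
      q : ℕ
      q = proj₁ (finite-order g)

    power-below-order : ∀ m → ∃[ r ] r ℕ.< suc q × g ^ m ≡ g ^ r
    power-below-order zero = 0 , s≤s z≤n , refl
    power-below-order (suc m) with power-below-order m
    ... | r , r<1+q , gᵐ≡gʳ with ℕ.<-cmp r q
    ...   | tri< r<q _ _  = suc r , s≤s r<q , cong (g ∙_) gᵐ≡gʳ
    ...   | tri≈ _ refl _ = 0 , s≤s z≤n , trans (cong (g ∙_) gᵐ≡gʳ) (proj₂ (finite-order g))
    ...   | tri> _ _ q<r  = ⊥-elim (<⇒≱ q<r (s≤s⁻¹ r<1+q))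

    inverse-as-power : g ⁻¹ ≡ g ^ q
    inverse-as-power = sym (inverseʳ-unique g (g ^ q) (proj₂ (finite-order g)))

    inverse-power-as-power : ∀ a → ∃[ m ] (g ^ a) ⁻¹ ≡ g ^ m
    inverse-power-as-power zero    = 0 , ε⁻¹≈ε
    inverse-power-as-power (suc a) =
      let m , gᵃ⁻¹≡gᵐ = inverse-power-as-power a
      in m + q , (begin
        (g ∙ g ^ a) ⁻¹      ≡⟨ ⁻¹-anti-homo-∙ g (g ^ a) ⟩
        (g ^ a) ⁻¹ ∙ g ⁻¹   ≡⟨ cong₂ _∙_ gᵃ⁻¹≡gᵐ inverse-as-power ⟩
        g ^ m ∙ g ^ q       ≡⟨ ^-+ g m q ⟨
        g ^ (m + q)         ∎)

    powℤ-as-power : ∀ k → ∃[ m ] powℤ G g k ≡ g ^ m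
    powℤ-as-power (+ m)     = m , refl
    powℤ-as-power -[1+ a ]  = inverse-power-as-power (suc a)

    ∈⟨⟩-below-order : ∀ {x} → x ∈⟨ g ⟩ → ∃[ i ] x ≡ g ^ toℕ {suc q} i
    ∈⟨⟩-below-order {x} (k , x≡gᵏ) =
      let m , gᵏ≡gᵐ = powℤ-as-power k
          r , r<1+q , gᵐ≡gʳ = power-below-order m
      in fromℕ< r<1+q , (begin
        x                      ≡⟨ x≡gᵏ ⟩
        powℤ G g k             ≡⟨ gᵏ≡gᵐ ⟩
        g ^ m                  ≡⟨ gᵐ≡gʳ ⟩
        g ^ r                  ≡⟨ cong (g ^_) (toℕ-fromℕ< r<1+q) ⟨
        g ^ toℕ (fromℕ< r<1+q) ∎)

  _∈⟨_⟩? : ∀ x g → Dec (x ∈⟨ g ⟩)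
  x ∈⟨ g ⟩? = map′ (λ (i , x≡gⁱ) → + toℕ i , x≡gⁱ) (∈⟨⟩-below-order g)
                   (any? λ i → x ≟ g ^ toℕ i)

  ∈⟨⟩-self : ∀ g → g ∈⟨ g ⟩
  ∈⟨⟩-self g = + 1 , sym (identityʳ g)

  ∈⟨⟩-⁻¹ : ∀ {x g} → x ∈⟨ g ⟩ → x ∈⟨ g ⁻¹ ⟩
  ∈⟨⟩-⁻¹ (+ zero , x≡ε) = + zero , x≡ε
  ∈⟨⟩-⁻¹ {x} {g} (+ suc j , x≡gʲ) = -[1+ j ] , (begin
    x                       ≡⟨ x≡gʲ ⟩
    g ^ suc j               ≡⟨ ⁻¹-involutive _ ⟨
    ((g ^ suc j) ⁻¹) ⁻¹     ≡⟨ cong _⁻¹ (⁻¹-^ g (suc j)) ⟨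
    ((g ⁻¹) ^ suc j) ⁻¹     ∎)
  ∈⟨⟩-⁻¹ {g = g} (-[1+ j ] , x≡g⁻ʲ) = + suc j , trans x≡g⁻ʲ (sym (⁻¹-^ g (suc j)))

  involution-powers : ∀ {g} → g ≡ g ⁻¹ → ∀ m → g ^ m ≡ ε ⊎ g ^ m ≡ g
  involution-powers g≡g⁻¹ zero = inj₁ refl
  involution-powers {g} g≡g⁻¹ (suc m) with involution-powers g≡g⁻¹ m
  ... | inj₁ gᵐ≡ε = inj₂ (trans (cong (g ∙_) gᵐ≡ε) (identityʳ g))
  ... | inj₂ gᵐ≡g = inj₁ (trans (cong (g ∙_) (trans gᵐ≡g g≡g⁻¹)) (inverseʳ g))

  ∈⟨involution⟩ : ∀ {g x} → g ≡ g ⁻¹ → x ∈⟨ g ⟩ → x ≡ ε ⊎ x ≡ g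
  ∈⟨involution⟩ {g} g≡g⁻¹ (k , x≡gᵏ) =
    let m , gᵏ≡gᵐ = powℤ-as-power g k
        x≡gᵐ = trans x≡gᵏ gᵏ≡gᵐ
    in Sum.map (trans x≡gᵐ) (trans x≡gᵐ) (involution-powers g≡g⁻¹ m)

  adjacent? : ∀ x y → Dec (PowAdj G x y)
  adjacent? x y = ¬? (x ≟ y) ×-dec ((x ∈⟨ y ⟩?) ⊎-dec (y ∈⟨ x ⟩?))

  PowAdj-sym : ∀ {x y} → PowAdj G x y → PowAdj G y x
  PowAdj-sym (x≢y , x~y) = ≢-sym x≢y , swap x~y

  orient : (Fin n → Fin n → Bool) → Fin n → Fin n → Bool
  orient t x y = does (adjacent? x y) ∧ t x y

  orient-arc : ∀ t {x y} → PowAdj G x y → t x y ≡ true → orient t x y ≡ true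
  orient-arc t {x} {y} x~y txy rewrite dec-true (adjacent? x y) x~y = txy

  orient-isOrientation : ∀ {t} → Tournament t → IsOrientation G (orient t)
  orient-isOrientation {t} t-flip = arc⇒adj , adj⇒arc , arc⇒¬arc
    where
      witness : ∀ {A : Set} (a? : Dec A) → does a? ≡ true → A
      witness (yes a) _ = a

      arc⇒adj : ∀ x y → orient t x y ≡ true → PowAdj G x y
      arc⇒adj x y x→y = witness (adjacent? x y) (∧-conicalˡ _ (t x y) x→y)

      adj⇒arc : ∀ x y → PowAdj G x y → orient t x y ≡ true ⊎ orient t y x ≡ true
      adj⇒arc x y x~y with t x y ≟ᵇ true
      ... | yes txy = inj₁ (orient-arc t x~y txy)
      ... | no ¬txy = inj₂ (orient-arc t (PowAdj-sym x~y)
                              (trans (t-flip x y (proj₁ x~y)) (cong not (¬-not ¬txy))))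

      arc⇒¬arc : ∀ x y → orient t x y ≡ true → ¬ orient t y x ≡ true
      arc⇒¬arc x y x→y y→x = not-¬ refl (begin
        t x y        ≡⟨ ∧-conicalʳ _ _ x→y ⟩
        true         ≡⟨ ∧-conicalʳ _ _ y→x ⟨
        t y x        ≡⟨ t-flip x y (proj₁ (arc⇒adj x y x→y)) ⟩
        not (t x y)  ∎)

  data _HasClass_ (x : Fin n) : Class → Set where
    is-neutral    : x ≡ ε → x HasClass neutral
    is-small      : x < x ⁻¹ → x HasClass small
    is-large      : x ⁻¹ < x → x HasClass large
    is-involutive : x ≢ ε → x ≡ x ⁻¹ → x HasClass involutive

  classify : ∀ x → ∃ (x HasClass_)
  classify x with x ≟ ε | <-cmp x (x ⁻¹)
  ... | yes x≡ε | _               = neutral , is-neutral x≡ε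
  ... | no _    | tri< x<x⁻¹ _ _  = small , is-small x<x⁻¹
  ... | no _    | tri> _ _ x⁻¹<x  = large , is-large x⁻¹<x
  ... | no x≢ε  | tri≈ _ x≡x⁻¹ _  = involutive , is-involutive x≢ε x≡x⁻¹

  class : Fin n → Class
  class x = proj₁ (classify x)

  ≡ε⇒selfInverse : ∀ {x} → x ≡ ε → x ≡ x ⁻¹
  ≡ε⇒selfInverse refl = sym ε⁻¹≈ε

  HasClass-functional : ∀ {x c d} → x HasClass c → x HasClass d → c ≡ d
  HasClass-functional (is-neutral _) (is-neutral _) = refl
  HasClass-functional (is-neutral x≡ε) (is-small x<x⁻¹) =
    ⊥-elim (<-irrefl (≡ε⇒selfInverse x≡ε) x<x⁻¹)
  HasClass-functional (is-neutral x≡ε) (is-large x⁻¹<x) =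
    ⊥-elim (<-irrefl (sym (≡ε⇒selfInverse x≡ε)) x⁻¹<x)
  HasClass-functional (is-neutral x≡ε) (is-involutive x≢ε _) = ⊥-elim (x≢ε x≡ε)
  HasClass-functional (is-small x<x⁻¹) (is-neutral x≡ε) =
    ⊥-elim (<-irrefl (≡ε⇒selfInverse x≡ε) x<x⁻¹)
  HasClass-functional (is-small _) (is-small _) = refl
  HasClass-functional (is-small x<x⁻¹) (is-large x⁻¹<x) = ⊥-elim (<-asym x<x⁻¹ x⁻¹<x)
  HasClass-functional (is-small x<x⁻¹) (is-involutive _ x≡x⁻¹) = ⊥-elim (<-irrefl x≡x⁻¹ x<x⁻¹)
  HasClass-functional (is-large x⁻¹<x) (is-neutral x≡ε) =
    ⊥-elim (<-irrefl (sym (≡ε⇒selfInverse x≡ε)) x⁻¹<x)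
  HasClass-functional (is-large x⁻¹<x) (is-small x<x⁻¹) = ⊥-elim (<-asym x<x⁻¹ x⁻¹<x)
  HasClass-functional (is-large _) (is-large _) = refl
  HasClass-functional (is-large x⁻¹<x) (is-involutive _ x≡x⁻¹) =
    ⊥-elim (<-irrefl (sym x≡x⁻¹) x⁻¹<x)
  HasClass-functional (is-involutive x≢ε _) (is-neutral x≡ε) = ⊥-elim (x≢ε x≡ε)
  HasClass-functional (is-involutive _ x≡x⁻¹) (is-small x<x⁻¹) = ⊥-elim (<-irrefl x≡x⁻¹ x<x⁻¹)
  HasClass-functional (is-involutive _ x≡x⁻¹) (is-large x⁻¹<x) =
    ⊥-elim (<-irrefl (sym x≡x⁻¹) x⁻¹<x)
  HasClass-functional (is-involutive _ _) (is-involutive _ _) = refl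

  class-of : ∀ {x c} → x HasClass c → class x ≡ c
  class-of {x} x∈c = HasClass-functional (proj₂ (classify x)) x∈c

  small⇒inverse-large : ∀ {x} → x < x ⁻¹ → (x ⁻¹) ⁻¹ < x ⁻¹
  small⇒inverse-large {x} = subst (_< x ⁻¹) (sym (⁻¹-involutive x))

  large⇒inverse-small : ∀ {x} → x ⁻¹ < x → x ⁻¹ < (x ⁻¹) ⁻¹
  large⇒inverse-small {x} = subst (x ⁻¹ <_) (sym (⁻¹-involutive x))

  ≢⁻¹⇒≢ε : ∀ {x} → x ≢ x ⁻¹ → x ≢ ε
  ≢⁻¹⇒≢ε x≢x⁻¹ x≡ε = x≢x⁻¹ (≡ε⇒selfInverse x≡ε)

  ε-adjacent : ∀ {x} → x ≢ ε → PowAdj G x ε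
  ε-adjacent x≢ε = x≢ε , inj₂ (+ 0 , refl)

  inverse-adjacent : ∀ {x} → x ≢ x ⁻¹ → PowAdj G x (x ⁻¹)
  inverse-adjacent {x} x≢x⁻¹ = x≢x⁻¹ , inj₂ (-[1+ 0 ] , cong _⁻¹ (sym (identityʳ x)))

  direction : Fin n → Fin n → Bool
  direction x y = between (class x) (class y) (does (x <? y))

  direction-tournament : Tournament direction
  direction-tournament x y x≢y = begin
    between (class y) (class x) (does (y <? x))
      ≡⟨ cong (between _ _) (<ᵇ-tournament x y x≢y) ⟩
    between (class y) (class x) (not (does (x <? y)))
      ≡⟨ between-flip (class x) (class y) _ ⟩
    not (direction x y)
      ∎

  orientation : Fin n → Fin n → Bool
  orientation = orient direction

  open ReachProperties orientation using (Reach-arc)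

  arc : ∀ {x y c d} → x HasClass c → y HasClass d → PowAdj G x y →
        between c d (does (x <? y)) ≡ true → orientation x y ≡ true
  arc {x} {y} x∈c y∈d x~y c→d = orient-arc direction x~y
    (subst₂ (λ c d → between c d (does (x <? y)) ≡ true)
            (sym (class-of x∈c)) (sym (class-of y∈d)) c→d)

  large→ε : ∀ {x} → x ⁻¹ < x → orientation x ε ≡ true
  large→ε x⁻¹<x =
    arc (is-large x⁻¹<x) (is-neutral refl) (ε-adjacent (≢⁻¹⇒≢ε (≢-sym (<⇒≢ x⁻¹<x)))) refl

  ε→small : ∀ {x} → x < x ⁻¹ → orientation ε x ≡ true
  ε→small x<x⁻¹ =
    arc (is-neutral refl) (is-small x<x⁻¹) (PowAdj-sym (ε-adjacent (≢⁻¹⇒≢ε (<⇒≢ x<x⁻¹)))) refl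

  ε→involutive : ∀ {x} → x ≢ ε → x ≡ x ⁻¹ → orientation ε x ≡ true
  ε→involutive x≢ε x≡x⁻¹ =
    arc (is-neutral refl) (is-involutive x≢ε x≡x⁻¹) (PowAdj-sym (ε-adjacent x≢ε)) refl

  small→inverse : ∀ {x} → x < x ⁻¹ → orientation x (x ⁻¹) ≡ true
  small→inverse x<x⁻¹ =
    arc (is-small x<x⁻¹) (is-large (small⇒inverse-large x<x⁻¹)) (inverse-adjacent (<⇒≢ x<x⁻¹)) refl

  involution-hasOrderTwo : ∀ {u} → u ≢ ε → u ≡ u ⁻¹ → HasOrderTwo G u
  involution-hasOrderTwo {u} u≢ε u≡u⁻¹ =
    ε , u , ≢-sym u≢ε , (+ 0 , refl) , ∈⟨⟩-self u , λ _ → ∈⟨involution⟩ u≡u⁻¹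

  involution-maximal : ∀ {u} → u ≢ ε → u ≡ u ⁻¹ → (∀ h → u ∈⟨ h ⟩ → ¬ h ⁻¹ < h) →
                       MaximalCyclic G u
  involution-maximal {u} u≢ε u≡u⁻¹ no-large h u⊆h with u⊆h u (∈⟨⟩-self u) | <-cmp h (h ⁻¹)
  ... | u∈h | tri< h<h⁻¹ _ _ = ⊥-elim (no-large (h ⁻¹) (∈⟨⟩-⁻¹ u∈h) (small⇒inverse-large h<h⁻¹))
  ... | u∈h | tri> _ _ h⁻¹<h = ⊥-elim (no-large h u∈h h⁻¹<h)
  ... | u∈h | tri≈ _ h≡h⁻¹ _ with ∈⟨involution⟩ h≡h⁻¹ u∈h
  ...   | inj₁ u≡ε = ⊥-elim (u≢ε u≡ε)
  ...   | inj₂ refl = λ _ x∈u → x∈u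

  involution-reach-ε : NoMaxCyclicOfOrderTwo G → ∀ {u} → u ≢ ε → u ≡ u ⁻¹ →
                       Reach orientation 2 u ε
  involution-reach-ε noMax {u} u≢ε u≡u⁻¹ with any? (λ h → (u ∈⟨ h ⟩?) ×-dec (h ⁻¹ <? h))
  ... | yes (h , u∈h , h⁻¹<h) = Reach-arc u→h (Reach-arc (large→ε h⁻¹<h) refl)
    where
      u≢h : u ≢ h
      u≢h refl = <-irrefl (sym u≡u⁻¹) h⁻¹<h

      u→h : orientation u h ≡ true
      u→h = arc (is-involutive u≢ε u≡u⁻¹) (is-large h⁻¹<h) (u≢h , inj₁ u∈h) refl
  ... | no ∄h = ⊥-elim (noMax (u , maximal , involution-hasOrderTwo u≢ε u≡u⁻¹))
    where
      maximal : MaximalCyclic G u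
      maximal = involution-maximal u≢ε u≡u⁻¹ λ h u∈h h⁻¹<h → ∄h (h , u∈h , h⁻¹<h)

  reach-ε : NoMaxCyclicOfOrderTwo G → ∀ u → Reach orientation 2 u ε
  reach-ε noMax u = reach (proj₂ (classify u))
    where
      reach : ∀ {c} → u HasClass c → Reach orientation 2 u ε
      reach (is-neutral u≡ε) = inj₁ u≡ε
      reach (is-large u⁻¹<u) = Reach-arc (large→ε u⁻¹<u) (inj₁ refl)
      reach (is-small u<u⁻¹) =
        Reach-arc (small→inverse u<u⁻¹) (Reach-arc (large→ε (small⇒inverse-large u<u⁻¹)) refl)
      reach (is-involutive u≢ε u≡u⁻¹) = involution-reach-ε noMax u≢ε u≡u⁻¹

  ε-reaches : ∀ v → Reach orientation 2 ε v
  ε-reaches v = reach (proj₂ (classify v))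
    where
      reach : ∀ {c} → v HasClass c → Reach orientation 2 ε v
      reach (is-neutral v≡ε) = inj₁ (sym v≡ε)
      reach (is-small v<v⁻¹) = Reach-arc (ε→small v<v⁻¹) (inj₁ refl)
      reach (is-involutive v≢ε v≡v⁻¹) = Reach-arc (ε→involutive v≢ε v≡v⁻¹) (inj₁ refl)
      reach (is-large v⁻¹<v) = Reach-arc (ε→small v⁻¹-small) (Reach-arc v⁻¹→v refl)
        where
          v⁻¹-small : v ⁻¹ < (v ⁻¹) ⁻¹
          v⁻¹-small = large⇒inverse-small v⁻¹<v

          v⁻¹→v : orientation (v ⁻¹) v ≡ true
          v⁻¹→v = subst (λ w → orientation (v ⁻¹) w ≡ true) (⁻¹-involutive v)
                        (small→inverse v⁻¹-small)

mainTheorem1 : (n : ℕ) (G : FinGroup n) → NoMaxCyclicOfOrderTwo G →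
                   OrientedDiamAtMost G 4
mainTheorem1 n G noMax =
  orientation G ,
  orient-isOrientation G (direction-tournament G) ,
  λ u v → Reach-++ 2 (reach-ε G noMax u) (ε-reaches G v)
  where open ReachProperties (orientation G) using (Reach-++)
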